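{- Let $H$ be a bipartite graph and let $u,v$ be adjacent vertices of $H$, both of degree $3$. Let $u_1,u_2$ be the two neighbours of $u$ other than $v$, and $v_1,v_2$ the two neighbours of $v$ other than $u$. Then there exists a largest independent edge set $M$ in $H$ for which either (1) one of the edges $uv,uu_1,uu_2,vv_1,vv_2$ belongs to $M$, or (2) both $u_1$ and $u_2$ are endpoints of edges in $M$, or (3) both $v_1$ and $v_2$ are endpoints of edges in $M$ and neither $u_1$ nor $u_2$ is an endpoint of an edge in $M$.
   Context: For a graph $H=(W,F)$, a set of edges $M\subseteq F$ is independent if no two edges of $M$ share an endpoint and the set $W(M)$ of endpoints of edges of $M$ is an independent set in $(W,F\setminus M)$. A largest independent edge set is one of maximum cardinality. -}

module Defs where

open import Data.Nat using (ℕ; _≤_)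
open import Data.Fin using (Fin)
open import Data.Bool using (Bool)
open import Data.List using (List; length; filter; allFin)

open import Data.Product using (_×_; _,_; proj₁; proj₂; ∃)
open import Data.Sum using (_⊎_)
open import Data.Empty using (⊥)
open import Relation.Nullary using (¬_; Dec)
open import Relation.Binary.PropositionalEquality using (_≡_; _≢_)
open import Data.List.Membership.Propositional using (_∈_)
open import Data.List.Relation.Unary.Any using (Any)
open import Data.List.Relation.Unary.AllPairs using (AllPairs)

record Graph (n : ℕ) : Set₁ where
  field
    Adj     : Fin n → Fin n → Set
    adj?    : ∀ x y → Dec (Adj x y)
    sym     : ∀ {x y} → Adj x y → Adj y x
    irrefl  : ∀ {x} → ¬ Adj x x
open Graph public

degree : ∀ {n} → Graph n → Fin n → ℕ
degree G x = length (filter (adj? G x) (allFin _))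

Bipartite : ∀ {n} → Graph n → Set
Bipartite {n} G = ∃ λ (c : Fin n → Bool) → ∀ x y → Adj G x y → c x ≢ c y

-- An edge set, represented as a list of (ordered representatives of) edges.
EdgeList : ℕ → Set
EdgeList n = List (Fin n × Fin n)

InM : ∀ {n} → EdgeList n → Fin n → Fin n → Set
InM M x y = (x , y) ∈ M ⊎ (y , x) ∈ M

Endpoint : ∀ {n} → EdgeList n → Fin n → Set
Endpoint M x = Any (λ e → x ≡ proj₁ e ⊎ x ≡ proj₂ e) M

Disjoint : ∀ {n} → (Fin n × Fin n) → (Fin n × Fin n) → Set
Disjoint (a , b) (c , d) = a ≢ c × a ≢ d × b ≢ c × b ≢ d

-- M ⊆ F, no two (distinct list entries) edges of M share an endpoint, and
-- W(M) is independent in (W, F \ M).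
IndependentEdgeSet : ∀ {n} → Graph n → EdgeList n → Set
IndependentEdgeSet G M =
  (∀ {x y} → (x , y) ∈ M → Adj G x y)
  × AllPairs Disjoint M
  × (∀ x y → Endpoint M x → Endpoint M y → Adj G x y → InM M x y)

LargestIndependentEdgeSet : ∀ {n} → Graph n → EdgeList n → Set
LargestIndependentEdgeSet G M =
  IndependentEdgeSet G M × (∀ M' → IndependentEdgeSet G M' → length M' ≤ length M)

-- Take a largest independent edge set M. If it contains none of the five
-- edges at u and v, then u and v are not covered by M. If exactly one
-- neighbour x of u other than v is covered, by the edge e of M, then
-- replacing e by ux gives an independent edge set of the same size: x
-- stays covered, the other end of e is released, and u has no other covered
-- neighbour. The same works at v. In the remaining cases either (2) or (3)
-- holds, or none of u₁, u₂, v₁, v₂ is covered and uv could be added to M,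
-- contradicting maximality.
module Submission where

open import Defs
open import Function using (_∘_)
open import Data.Nat using (ℕ; zero; suc; _≤_; z≤n; s≤s)
open import Data.Nat.Properties using (≤-reflexive; ≤-trans; n≮n)
open import Data.Fin using (Fin; _≟_)
open import Data.Fin.Properties using (all?)
open import Data.Product using (_×_; ∃; _,_; proj₁; proj₂)
import Data.Product as Product
open import Data.Product.Properties using (≡-dec)
open import Data.Sum using (_⊎_; inj₁; inj₂)
import Data.Sum as Sum
open import Data.Empty using (⊥; ⊥-elim)
open import Data.List using (List; []; _∷_; [_]; length; filter; allFin; cartesianProduct; cartesianProductWith)
open import Data.List.Properties using (length-removeAt′)
open import Data.List.Membership.Propositional using (_∈_; _∉_; find)
open import Data.List.Membership.Propositional.Properties
  using (∈-filter⁺; ∈-allFin; ∈-cartesianProduct⁺; ∈-cartesianProductWith⁺)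
open import Data.List.Relation.Unary.Any using (Any; here; there; index; _─_)
import Data.List.Relation.Unary.Any as Any
open import Data.List.Relation.Unary.All using (All; []; _∷_)
import Data.List.Relation.Unary.All as All
open import Data.List.Relation.Unary.All.Properties using (all-filter; ¬Any⇒All¬)
open import Data.List.Relation.Unary.AllPairs using (AllPairs; []; _∷_; allPairs?)
import Data.List.Relation.Unary.AllPairs as AllPairs
open import Data.List.Relation.Unary.Unique.Propositional using (Unique)
open import Data.List.Relation.Binary.Subset.Propositional using (_⊆_)
open import Data.List.Relation.Binary.Sublist.Propositional as Sublist using ([]; _∷_; _∷ʳ_; ⊆-refl)
open import Data.List.Relation.Binary.Sublist.Propositional.Properties using (All-resp-⊆)
open import Data.List.Extrema.Nat using (argmax; argmax-all; f[xs]≤f[argmax])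
open import Relation.Nullary using (¬_; Dec; yes; no)
open import Relation.Nullary.Decidable using (map′; _×-dec_; _⊎-dec_; _→-dec_; ¬?)
open import Relation.Binary.PropositionalEquality
  using (_≡_; _≢_; refl; subst) renaming (sym to ≡-sym)

module _ {A : Set} where

  ─⊆ : ∀ {P : A → Set} {xs : List A} (p : Any P xs) → (xs ─ p) Sublist.⊆ xs
  ─⊆ {xs = x ∷ _} (here _) = x ∷ʳ ⊆-refl
  ─⊆ (there p) = refl ∷ ─⊆ p

  ∈-─⁺ : ∀ {x y : A} {xs} (p : x ∈ xs) → y ∈ xs → y ≢ x → y ∈ (xs ─ p)
  ∈-─⁺ (here refl) (here refl) y≢x = ⊥-elim (y≢x refl)
  ∈-─⁺ (here _) (there q) _ = q
  ∈-─⁺ (there p) (here refl) _ = here refl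
  ∈-─⁺ (there p) (there q) y≢x = there (∈-─⁺ p q y≢x)

  ∉-─ : ∀ {R : A → A → Set} {x : A} {xs} → (∀ {y} → ¬ R y y) → AllPairs R xs → (p : x ∈ xs) → x ∉ (xs ─ p)
  ∉-─ irr (r ∷ _) (here refl) q = irr (All.lookup r q)
  ∉-─ irr (r ∷ _) (there p) (here refl) = irr (All.lookup r p)
  ∉-─ irr (_ ∷ rs) (there p) (there q) = ∉-─ irr rs p q

  AllPairs-resp-⊆ : ∀ {R : A → A → Set} {xs ys : List A} → xs Sublist.⊆ ys → AllPairs R ys → AllPairs R xs
  AllPairs-resp-⊆ [] [] = []
  AllPairs-resp-⊆ (_ ∷ʳ τ) (_ ∷ rs) = AllPairs-resp-⊆ τ rs
  AllPairs-resp-⊆ (refl ∷ τ) (r ∷ rs) = All-resp-⊆ τ r ∷ AllPairs-resp-⊆ τ rs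

  Unique-⊆⇒length≤ : ∀ {xs ys : List A} → Unique xs → xs ⊆ ys → length xs ≤ length ys
  Unique-⊆⇒length≤ [] _ = z≤n
  Unique-⊆⇒length≤ {x ∷ xs} {ys} (x∉xs ∷ uniq) sub =
    ≤-trans (s≤s (Unique-⊆⇒length≤ uniq sub′)) (≤-reflexive (≡-sym (length-removeAt′ ys (index x∈ys))))
    where
      x∈ys = sub (here refl)
      sub′ : xs ⊆ (ys ─ x∈ys)
      sub′ y∈xs = ∈-─⁺ x∈ys (sub (there y∈xs)) (λ y≡x → All.lookup x∉xs y∈xs (≡-sym y≡x))

  listsOfLength≤ : List A → ℕ → List (List A)
  listsOfLength≤ as zero = [ [] ]
  listsOfLength≤ as (suc k) = [] ∷ cartesianProductWith _∷_ as (listsOfLength≤ as k)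

  ∈-listsOfLength≤ : ∀ {as xs : List A} k → xs ⊆ as → length xs ≤ k → xs ∈ listsOfLength≤ as k
  ∈-listsOfLength≤ {xs = []} zero _ _ = here refl
  ∈-listsOfLength≤ {xs = []} (suc k) _ _ = here refl
  ∈-listsOfLength≤ {xs = x ∷ xs} (suc k) sub (s≤s len≤k) =
    there (∈-cartesianProductWith⁺ _∷_ (sub (here refl)) (∈-listsOfLength≤ k (sub ∘ there) len≤k))

module _ {n : ℕ} where

  Incident : Fin n → Fin n × Fin n → Set
  Incident x e = x ≡ proj₁ e ⊎ x ≡ proj₂ e

  Free : EdgeList n → Fin n → Set
  Free M x = ¬ Endpoint M x

  ∈⇒endpoint : ∀ {M : EdgeList n} {x e} → e ∈ M → Incident x e → Endpoint M x
  ∈⇒endpoint e∈M xe = Any.map (λ { refl → xe }) e∈M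

  free⇒≢ : ∀ {M : EdgeList n} {x y e} → Free M x → e ∈ M → Incident y e → x ≢ y
  free⇒≢ x-free e∈M ye refl = x-free (∈⇒endpoint e∈M ye)

  Disjoint-irrefl : ∀ {e : Fin n × Fin n} → ¬ Disjoint e e
  Disjoint-irrefl {_ , _} (a≢a , _) = a≢a refl

  Disjoint⇒¬shared : ∀ {x : Fin n} {e g} → Disjoint e g → Incident x e → Incident x g → ⊥
  Disjoint⇒¬shared {e = _ , _} {_ , _} (a≢c , _ , _ , _) (inj₁ refl) (inj₁ refl) = a≢c refl
  Disjoint⇒¬shared {e = _ , _} {_ , _} (_ , a≢d , _ , _) (inj₁ refl) (inj₂ refl) = a≢d refl
  Disjoint⇒¬shared {e = _ , _} {_ , _} (_ , _ , b≢c , _) (inj₂ refl) (inj₁ refl) = b≢c refl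
  Disjoint⇒¬shared {e = _ , _} {_ , _} (_ , _ , _ , b≢d) (inj₂ refl) (inj₂ refl) = b≢d refl

  incident-unique : ∀ {M : EdgeList n} {x g h} → AllPairs Disjoint M → g ∈ M → h ∈ M → Incident x g → Incident x h → g ≡ h
  incident-unique _ (here refl) (here refl) _ _ = refl
  incident-unique (d ∷ _) (here refl) (there h∈M) xg xh = ⊥-elim (Disjoint⇒¬shared (All.lookup d h∈M) xg xh)
  incident-unique (d ∷ _) (there g∈M) (here refl) xg xh = ⊥-elim (Disjoint⇒¬shared (All.lookup d g∈M) xh xg)
  incident-unique (_ ∷ ds) (there g∈M) (there h∈M) xg xh = incident-unique ds g∈M h∈M xg xh

  vertexPairs : List (Fin n × Fin n)
  vertexPairs = cartesianProduct (allFin n) (allFin n)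

  ∈-vertexPairs : ∀ e → e ∈ vertexPairs
  ∈-vertexPairs (x , y) = ∈-cartesianProduct⁺ (∈-allFin x) (∈-allFin y)

  matching-length≤ : ∀ {M : EdgeList n} → AllPairs Disjoint M → length M ≤ length vertexPairs
  matching-length≤ disj =
    Unique-⊆⇒length≤ (AllPairs.map (λ d e≡g → Disjoint-irrefl (subst (Disjoint _) (≡-sym e≡g) d)) disj)
                     (λ {e} _ → ∈-vertexPairs e)

  endpoint? : ∀ (M : EdgeList n) x → Dec (Endpoint M x)
  endpoint? M x = Any.any? (λ e → (x ≟ proj₁ e) ⊎-dec (x ≟ proj₂ e)) M

  inM? : ∀ (M : EdgeList n) x y → Dec (InM M x y)
  inM? M x y = Any.any? (≡-dec _≟_ _≟_ (x , y)) M ⊎-dec Any.any? (≡-dec _≟_ _≟_ (y , x)) M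

  disjoint? : ∀ e g → Dec (Disjoint {n} e g)
  disjoint? (a , b) (c , d) = ¬? (a ≟ c) ×-dec ¬? (a ≟ d) ×-dec ¬? (b ≟ c) ×-dec ¬? (b ≟ d)

module _ {n : ℕ} (G : Graph n) where

  neighbours : Fin n → List (Fin n)
  neighbours c = filter (adj? G c) (allFin n)

  neighbour-∈ : ∀ {c w : Fin n} {xs} → Unique xs → All (Adj G c) xs → degree G c ≤ length xs → Adj G c w → w ∈ xs
  neighbour-∈ {c} {w} {xs} uniq adj deg≤ cw with Any.any? (w ≟_) xs
  ... | yes w∈xs = w∈xs
  ... | no w∉xs = ⊥-elim (n≮n _ (≤-trans (Unique-⊆⇒length≤ (¬Any⇒All¬ xs w∉xs ∷ uniq) sub) deg≤))
    where
      sub : w ∷ xs ⊆ neighbours c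
      sub (here refl) = ∈-filter⁺ (adj? G c) (∈-allFin w) cw
      sub (there y∈xs) = ∈-filter⁺ (adj? G c) (∈-allFin _) (All.lookup adj y∈xs)

  NeighbourhoodFree : EdgeList n → Fin n → Set
  NeighbourhoodFree M x = Free M x × (∀ {w} → Adj G x w → Free M w)

  independent-[] : IndependentEdgeSet G []
  independent-[] = (λ ()) , [] , λ _ _ ()

  independent-⊆ : ∀ {M M′ : EdgeList n} → IndependentEdgeSet G M → M′ Sublist.⊆ M → IndependentEdgeSet G M′
  independent-⊆ {M} {M′} (adj , disj , closed) τ = adj ∘ Sublist.lookup τ , AllPairs-resp-⊆ τ disj , closed′
    where
      closed′ : ∀ x y → Endpoint M′ x → Endpoint M′ y → Adj G x y → InM M′ x y
      closed′ x y x∈W y∈W xy with find x∈W | closed x y (Sublist.lookup τ x∈W) (Sublist.lookup τ y∈W) xy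
      ... | g , g∈M′ , xg | inj₁ xy∈M =
        inj₁ (subst (_∈ M′) (≡-sym (incident-unique disj xy∈M (Sublist.lookup τ g∈M′) (inj₁ refl) xg)) g∈M′)
      ... | g , g∈M′ , xg | inj₂ yx∈M =
        inj₂ (subst (_∈ M′) (≡-sym (incident-unique disj yx∈M (Sublist.lookup τ g∈M′) (inj₂ refl) xg)) g∈M′)

  independent-∷ : ∀ {M : EdgeList n} {a b} → IndependentEdgeSet G M → Adj G a b →
                  NeighbourhoodFree M a → NeighbourhoodFree M b → IndependentEdgeSet G ((a , b) ∷ M)
  independent-∷ {M} {a} {b} (adj , disj , closed) ab (a-free , Na-free) (b-free , Nb-free) =
    adj′ , All.tabulate disjoint ∷ disj , closed′
    where
      adj′ : ∀ {x y} → (x , y) ∈ (a , b) ∷ M → Adj G x y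
      adj′ (here refl) = ab
      adj′ (there xy∈M) = adj xy∈M

      disjoint : ∀ {g} → g ∈ M → Disjoint (a , b) g
      disjoint {_ , _} g∈M =
        free⇒≢ a-free g∈M (inj₁ refl) , free⇒≢ a-free g∈M (inj₂ refl) ,
        free⇒≢ b-free g∈M (inj₁ refl) , free⇒≢ b-free g∈M (inj₂ refl)

      closed′ : ∀ x y → Endpoint ((a , b) ∷ M) x → Endpoint ((a , b) ∷ M) y → Adj G x y → InM ((a , b) ∷ M) x y
      closed′ _ _ (here (inj₁ refl)) (here (inj₁ refl)) aa = ⊥-elim (irrefl G aa)
      closed′ _ _ (here (inj₁ refl)) (here (inj₂ refl)) _ = inj₁ (here refl)
      closed′ _ _ (here (inj₂ refl)) (here (inj₁ refl)) _ = inj₂ (here refl)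
      closed′ _ _ (here (inj₂ refl)) (here (inj₂ refl)) bb = ⊥-elim (irrefl G bb)
      closed′ _ _ (here (inj₁ refl)) (there y∈W) ay = ⊥-elim (Na-free ay y∈W)
      closed′ _ _ (here (inj₂ refl)) (there y∈W) by = ⊥-elim (Nb-free by y∈W)
      closed′ _ _ (there x∈W) (here (inj₁ refl)) xa = ⊥-elim (Na-free (sym G xa) x∈W)
      closed′ _ _ (there x∈W) (here (inj₂ refl)) xb = ⊥-elim (Nb-free (sym G xb) x∈W)
      closed′ x y (there x∈W) (there y∈W) xy = Sum.map there there (closed x y x∈W y∈W xy)

  independent? : ∀ M → Dec (IndependentEdgeSet G M)
  independent? M =
    edges-adjacent? ×-dec allPairs? disjoint? M ×-dec
    all? (λ x → all? (λ y → endpoint? M x →-dec endpoint? M y →-dec adj? G x y →-dec inM? M x y))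
    where
      edges-adjacent? : Dec (∀ {x y} → (x , y) ∈ M → Adj G x y)
      edges-adjacent? = map′ (λ all → All.lookup all) (λ adj → All.tabulate adj)
        (All.all? {P = λ e → Adj G (proj₁ e) (proj₂ e)} (λ e → adj? G (proj₁ e) (proj₂ e)) M)

  Largest : EdgeList n → Set
  Largest = LargestIndependentEdgeSet G

  -- Independent edge sets repeat no edge, so they are no longer than vertexPairs;
  -- a longest independent list of at most that length is therefore largest.
  largest-exists : ∃ Largest
  largest-exists = M , argmax-all length independent-[] (all-filter independent? short-lists) , largest
    where
      short-lists candidates : List (EdgeList n)
      short-lists = listsOfLength≤ vertexPairs (length (vertexPairs {n}))
      candidates = filter independent? short-lists
      M : EdgeList n
      M = argmax length [] candidates
      largest : ∀ (M′ : EdgeList n) → IndependentEdgeSet G M′ → length M′ ≤ length M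
      largest M′ ind = All.lookup (f[xs]≤f[argmax] {f = length} [] candidates)
        (∈-filter⁺ independent?
          (∈-listsOfLength≤ (length (vertexPairs {n})) (λ {e} _ → ∈-vertexPairs e)
                            (matching-length≤ (proj₁ (proj₂ ind))))
          ind)

  not-augmentable : ∀ {M : EdgeList n} {a b} → Largest M → Adj G a b → NeighbourhoodFree M a → NeighbourhoodFree M b → ⊥
  not-augmentable (ind , largest) ab a-free b-free = n≮n _ (largest _ (independent-∷ ind ab a-free b-free))

  matched-partner : ∀ {M : EdgeList n} {c} → IndependentEdgeSet G M → Endpoint M c → ∃ λ t → Adj G c t × InM M c t
  matched-partner (adj , _) c∈W with find c∈W
  ... | (_ , t) , e∈M , inj₁ refl = t , adj e∈M , inj₁ e∈M
  ... | (t , _) , e∈M , inj₂ refl = t , sym G (adj e∈M) , inj₂ e∈M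

  unmatched⇒free : ∀ {M : EdgeList n} {c ns} → IndependentEdgeSet G M → (∀ {w} → Adj G c w → w ∈ ns) →
                   All (λ w → ¬ InM M c w) ns → Free M c
  unmatched⇒free ind N unmatched c∈W with matched-partner ind c∈W
  ... | t , ct , ct∈M = All.lookup unmatched (N ct) ct∈M

  only-covered-neighbour : ∀ {M : EdgeList n} {c t ns} → (∀ {w} → Adj G c w → w ∈ ns) →
                           All (λ w → w ≡ t ⊎ Free M w) ns → ∀ {w} → Adj G c w → Endpoint M w → w ≡ t
  only-covered-neighbour N covered cw w∈W with All.lookup covered (N cw)
  ... | inj₁ w≡t = w≡t
  ... | inj₂ w-free = ⊥-elim (w-free w∈W)

  exchange : ∀ {M : EdgeList n} {c t} → IndependentEdgeSet G M → Free M c → Adj G c t → Endpoint M t →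
             (∀ {w} → Adj G c w → Endpoint M w → w ≡ t) →
             ∃ λ M′ → IndependentEdgeSet G M′ × length M′ ≡ length M × InM M′ c t
  exchange {M} {c} {t} ind@(_ , disj , closed) c-free ct t∈W only-t with find t∈W
  ... | e , e∈M , te =
    (c , t) ∷ R ,
    independent-∷ (independent-⊆ ind R⊆M) ct (c-free ∘ W⊆ , Nc-free) (free-R te , Nt-free) ,
    ≡-sym (length-removeAt′ M (index e∈M)) ,
    inj₁ (here refl)
    where
      R = M ─ e∈M
      R⊆M = ─⊆ e∈M
      W⊆ : ∀ {x} → Endpoint R x → Endpoint M x
      W⊆ = Sublist.lookup R⊆M

      free-R : ∀ {x} → Incident x e → Free R x
      free-R xe x∈WR with find x∈WR
      ... | g , g∈R , xg = ∉-─ Disjoint-irrefl disj e∈M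
        (subst (_∈ R) (incident-unique disj (Sublist.lookup R⊆M g∈R) e∈M xg xe) g∈R)

      Nc-free : ∀ {w} → Adj G c w → Free R w
      Nc-free cw w∈WR with only-t cw (W⊆ w∈WR)
      ... | refl = free-R te w∈WR

      Nt-free : ∀ {w} → Adj G t w → Free R w
      Nt-free {w} tw w∈WR with closed t w t∈W (W⊆ w∈WR) tw
      ... | inj₁ tw∈M = free-R (subst (Incident w) (incident-unique disj tw∈M e∈M (inj₁ refl) te) (inj₂ refl)) w∈WR
      ... | inj₂ wt∈M = free-R (subst (Incident w) (incident-unique disj wt∈M e∈M (inj₂ refl) te) (inj₁ refl)) w∈WR

  exchange-largest : ∀ {M : EdgeList n} {c t} → Largest M → Free M c → Adj G c t → Endpoint M t →
                     (∀ {w} → Adj G c w → Endpoint M w → w ≡ t) → ∃ λ M′ → Largest M′ × InM M′ c t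
  exchange-largest (ind , largest) c-free ct t∈W only-t with exchange ind c-free ct t∈W only-t
  ... | M′ , ind′ , same-length , ct∈M′ =
    M′ , (ind′ , λ M″ ind″ → subst (length M″ ≤_) (≡-sym same-length) (largest M″ ind″)) , ct∈M′

  star-trichotomy : ∀ {M : EdgeList n} {c d x y} → Largest M → (∀ {w} → Adj G c w → w ∈ d ∷ x ∷ y ∷ []) →
                    Adj G c x → Adj G c y → Free M c → Free M d →
                    (Endpoint M x × Endpoint M y) ⊎ (∃ λ M′ → Largest M′ × (InM M′ c x ⊎ InM M′ c y)) ⊎ (Free M x × Free M y)
  star-trichotomy {M} {x = x} {y} largest N cx cy c-free d-free with endpoint? M x | endpoint? M y
  ... | yes x∈W | yes y∈W = inj₁ (x∈W , y∈W)
  ... | yes x∈W | no y-free = inj₂ (inj₁ (Product.map₂ (Product.map₂ inj₁)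
        (exchange-largest largest c-free cx x∈W (only-covered-neighbour N (inj₂ d-free ∷ inj₁ refl ∷ inj₂ y-free ∷ [])))))
  ... | no x-free | yes y∈W = inj₂ (inj₁ (Product.map₂ (Product.map₂ inj₂)
        (exchange-largest largest c-free cy y∈W (only-covered-neighbour N (inj₂ d-free ∷ inj₂ x-free ∷ inj₁ refl ∷ [])))))
  ... | no x-free | no y-free = inj₂ (inj₂ (x-free , y-free))

  ends-free : ∀ {M : EdgeList n} {u v u₁ u₂ v₁ v₂} → IndependentEdgeSet G M →
              (∀ {w} → Adj G u w → w ∈ v ∷ u₁ ∷ u₂ ∷ []) → (∀ {w} → Adj G v w → w ∈ u ∷ v₁ ∷ v₂ ∷ []) →
              ¬ (InM M u v ⊎ InM M u u₁ ⊎ InM M u u₂ ⊎ InM M v v₁ ⊎ InM M v v₂) → Free M u × Free M v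
  ends-free ind Nu Nv unmatched =
    unmatched⇒free ind Nu ((unmatched ∘ inj₁) ∷ (unmatched ∘ inj₂ ∘ inj₁) ∷ (unmatched ∘ inj₂ ∘ inj₂ ∘ inj₁) ∷ []) ,
    unmatched⇒free ind Nv ((unmatched ∘ inj₁ ∘ Sum.swap) ∷ (unmatched ∘ inj₂ ∘ inj₂ ∘ inj₂ ∘ inj₁) ∷
                           (unmatched ∘ inj₂ ∘ inj₂ ∘ inj₂ ∘ inj₂) ∷ [])

  StarCondition : (M : EdgeList n) (u v u₁ u₂ v₁ v₂ : Fin n) → Set
  StarCondition M u v u₁ u₂ v₁ v₂ =
    (InM M u v ⊎ InM M u u₁ ⊎ InM M u u₂ ⊎ InM M v v₁ ⊎ InM M v v₂)
    ⊎ (Endpoint M u₁ × Endpoint M u₂)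
    ⊎ (Endpoint M v₁ × Endpoint M v₂ × ¬ Endpoint M u₁ × ¬ Endpoint M u₂)

  star-condition : ∀ {M : EdgeList n} {u v u₁ u₂ v₁ v₂} → Largest M →
                   (∀ {w} → Adj G u w → w ∈ v ∷ u₁ ∷ u₂ ∷ []) → (∀ {w} → Adj G v w → w ∈ u ∷ v₁ ∷ v₂ ∷ []) →
                   Adj G u v → Adj G u u₁ → Adj G u u₂ → Adj G v v₁ → Adj G v v₂ →
                   ∃ λ M′ → Largest M′ × StarCondition M′ u v u₁ u₂ v₁ v₂
  star-condition {M} {u} {v} {u₁} {u₂} {v₁} {v₂} largest Nu Nv uv uu₁ uu₂ vv₁ vv₂
    with inM? M u v ⊎-dec inM? M u u₁ ⊎-dec inM? M u u₂ ⊎-dec inM? M v v₁ ⊎-dec inM? M v v₂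
  ... | yes matched = M , largest , inj₁ matched
  ... | no unmatched
    with u-free , v-free ← ends-free (proj₁ largest) Nu Nv unmatched
    with star-trichotomy largest Nu uu₁ uu₂ u-free v-free
  ...   | inj₁ covered = M , largest , inj₂ (inj₁ covered)
  ...   | inj₂ (inj₁ (M′ , largest′ , matched)) = M′ , largest′ , inj₁ (inj₂ (Sum.map₂ inj₁ matched))
  ...   | inj₂ (inj₂ (u₁-free , u₂-free))
    with star-trichotomy largest Nv vv₁ vv₂ v-free u-free
  ...     | inj₁ (v₁∈W , v₂∈W) = M , largest , inj₂ (inj₂ (v₁∈W , v₂∈W , u₁-free , u₂-free))
  ...     | inj₂ (inj₁ (M′ , largest′ , matched)) = M′ , largest′ , inj₁ (inj₂ (inj₂ (inj₂ matched)))
  ...     | inj₂ (inj₂ (v₁-free , v₂-free)) =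
    ⊥-elim (not-augmentable largest uv (u-free , All.lookup (v-free ∷ u₁-free ∷ u₂-free ∷ []) ∘ Nu)
                                       (v-free , All.lookup (u-free ∷ v₁-free ∷ v₂-free ∷ []) ∘ Nv))

mainTheorem10 : ∀ {n} (H : Graph n) → Bipartite H →
    (u v u₁ u₂ v₁ v₂ : Fin n) →
    Adj H u v → degree H u ≡ 3 → degree H v ≡ 3 →
    Adj H u u₁ → Adj H u u₂ → u₁ ≢ u₂ → u₁ ≢ v → u₂ ≢ v →
    Adj H v v₁ → Adj H v v₂ → v₁ ≢ v₂ → v₁ ≢ u → v₂ ≢ u →
    ∃ λ M → LargestIndependentEdgeSet H M ×
      ((InM M u v ⊎ InM M u u₁ ⊎ InM M u u₂ ⊎ InM M v v₁ ⊎ InM M v v₂)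
       ⊎ (Endpoint M u₁ × Endpoint M u₂)
       ⊎ (Endpoint M v₁ × Endpoint M v₂ × ¬ Endpoint M u₁ × ¬ Endpoint M u₂))
mainTheorem10 H _ u v u₁ u₂ v₁ v₂ uv du dv uu₁ uu₂ u₁≢u₂ u₁≢v u₂≢v vv₁ vv₂ v₁≢v₂ v₁≢u v₂≢u =
  star-condition H (proj₂ (largest-exists H)) Nu Nv uv uu₁ uu₂ vv₁ vv₂
  where
    Nu : ∀ {w} → Adj H u w → w ∈ v ∷ u₁ ∷ u₂ ∷ []
    Nu = neighbour-∈ H ((u₁≢v ∘ ≡-sym ∷ u₂≢v ∘ ≡-sym ∷ []) ∷ (u₁≢u₂ ∷ []) ∷ [] ∷ []) (uv ∷ uu₁ ∷ uu₂ ∷ []) (≤-reflexive du)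
    Nv : ∀ {w} → Adj H v w → w ∈ u ∷ v₁ ∷ v₂ ∷ []
    Nv = neighbour-∈ H ((v₁≢u ∘ ≡-sym ∷ v₂≢u ∘ ≡-sym ∷ []) ∷ (v₁≢v₂ ∷ []) ∷ [] ∷ []) (sym H uv ∷ vv₁ ∷ vv₂ ∷ []) (≤-reflexive dv)
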